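{- Let $a,b$ be odd positive integers and $n$ a positive integer. Then $$t(a,a,b,b;n)=N(a,a,b,b;4n+a+b)-N\big(a,a,b,b;2n+\tfrac{a+b}2\big).$$
   Context: For positive integers $a_1,\dots,a_k$ and a nonnegative integer $n$, $N(a_1,\dots,a_k;n)$ is the number of $(x_1,\dots,x_k)\in\mathbb Z^k$ with $n=a_1x_1^2+\cdots+a_kx_k^2$, and $t(a_1,\dots,a_k;n)$ is the number of $(x_1,\dots,x_k)\in\mathbb Z^k$ with $n=a_1\frac{x_1(x_1-1)}2+\cdots+a_k\frac{x_k(x_k-1)}2$. -}

module Defs where

open import Data.Nat as ℕ using (ℕ; zero; suc)
open import Data.Integer as ℤ using (ℤ; +_; -[1+_])
open import Data.Integer.DivMod using (_/ℕ_)
open import Data.Nat.Divisibility using (_∣_)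
open import Relation.Nullary using (¬_)
open import Data.List using (List; []; _∷_; map; concatMap; length; filter; upTo)
open import Data.Vec using (Vec; []; _∷_)
open import Relation.Binary.PropositionalEquality using (_≡_)
import Data.Integer.Properties as ℤP

box : ℕ → List ℤ
box m = map (λ i → ℤ.+ i ℤ.- ℤ.+ m) (upTo (suc (2 ℕ.* m)))

tuples : (k m : ℕ) → List (Vec ℤ k)
tuples zero m = [] ∷ []
tuples (suc k) m = concatMap (λ x → map (x ∷_) (tuples k m)) (box m)

sqForm : ∀ {k} → Vec ℕ k → Vec ℤ k → ℤ
sqForm [] [] = + 0
sqForm (a ∷ as) (x ∷ xs) = + a ℤ.* (x ℤ.* x) ℤ.+ sqForm as xs

-- x(x-1)/2  (x(x-1) is always even, so the division is exact)
tri : ℤ → ℤ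
tri x = (x ℤ.* (x ℤ.- + 1)) /ℕ 2

triForm : ∀ {k} → Vec ℕ k → Vec ℤ k → ℤ
triForm [] [] = + 0
triForm (a ∷ as) (x ∷ xs) = + a ℤ.* tri x ℤ.+ triForm as xs

-- N(a;n): number of x ∈ ℤ^k with sqForm a x = n.  When all aᵢ ≥ 1 every
-- solution satisfies |xᵢ| ≤ n, so counting over the box [-(n+1), n+1]^k
-- counts all integer solutions.
N : ∀ {k} → Vec ℕ k → ℕ → ℕ
N {k} a n = length (filter (λ x → sqForm a x ℤ.≟ + n) (tuples k (suc n)))

-- t(a;n): number of x ∈ ℤ^k with triForm a x = n.  When all aᵢ ≥ 1 every
-- solution satisfies xᵢ(xᵢ-1) ≤ 2n, hence -n ≤ xᵢ ≤ n+1, so the box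
-- [-(n+1), n+1]^k contains all integer solutions.
t : ∀ {k} → Vec ℕ k → ℕ → ℕ
t {k} a n = length (filter (λ x → triForm a x ℤ.≟ + n) (tuples k (suc n)))

Odd : ℕ → Set
Odd m = ¬ (2 ∣ m)

{-# OPTIONS --safe #-}
module Submission where

-- Write a pair of integers (u₁, u₂) as (z₁ + z₂, z₁ - z₂) when u₁ + u₂ is even and as
-- (x₁ + x₂ - 1, x₁ - x₂) when it is odd; then u₁² + u₂² is 2(z₁² + z₂²), respectively
-- 4(T x₁ + T x₂) + 1 with T x = x(x - 1)/2.  In a solution u of
-- a(u₁² + u₂²) + b(u₃² + u₄²) = 4n + a + b with a, b odd both pairs are of the same kind:
-- otherwise, say, 2(a(z₁² + z₂²) + 2b(T x₃ + T x₄) - 2n) = a.  If both are even, z solves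
-- the square form at 2n + (a + b)/2; if both are odd, x solves the triangular form at n.
-- Both parametrisations are injective with disjoint images, and the finite boxes over
-- which N and t count contain every solution since a, b ≥ 1.

open import Defs
open import Data.Empty using (⊥; ⊥-elim)
open import Data.Integer using (ℤ; +_; -[1+_]; -_; 1ℤ; ∣_∣; _≟_)
open import Data.Integer.DivMod using (_/ℕ_; _%ℕ_; n%ℕd<d; a≡a%ℕn+[a/ℕn]*n)
import Data.Integer.Properties as Int
open import Algebra.Properties.AbelianGroup Int.+-0-abelianGroup using ()
  renaming (∙-cancelˡ to +-cancelˡ; ∙-cancelʳ to +-cancelʳ)
open import Algebra.Properties.CommutativeSemigroup Int.+-commutativeSemigroup using ()
  renaming (xy∙z≈xz∙y to +-swapʳ)
open import Data.Integer.Tactic.RingSolver using (solve-∀; solve)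
open import Data.List using (List; []; _∷_; _++_; map; concatMap; cartesianProductWith; filter; length)
open import Data.List.Membership.Propositional using (_∈_)
import Data.List.Membership.Propositional.Properties as ∈
open import Data.List.Membership.Propositional.Properties.WithK using (unique∧set⇒bag)
open import Data.List.Properties using (length-++; length-map)
open import Data.List.Relation.Binary.BagAndSetEquality using (∼bag⇒↭)
open import Data.List.Relation.Binary.Disjoint.Propositional using (Disjoint)
open import Data.List.Relation.Binary.Permutation.Propositional.Properties using (↭-length)
import Data.List.Relation.Unary.All as List
open import Data.List.Relation.Unary.Any using (here)
open import Data.List.Relation.Unary.Unique.Propositional using (Unique; []; _∷_)
import Data.List.Relation.Unary.Unique.Propositional.Properties as Unique
open import Data.Nat as ℕ using (ℕ; zero; suc; _≤_)
open import Data.Nat.DivMod using (_%_; m%n<n; %-distribˡ-+; m*n/n≡m; m*[n/m]≡n)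
open import Data.Nat.Divisibility using (_∣_; divides; m%n≡0⇒n∣m)
import Data.Nat.Properties as ℕ
import Data.Nat.Tactic.RingSolver as ℕ-Solver
open import Data.Product using (∃-syntax; _×_; _,_; proj₂)
open import Data.Sum using (_⊎_; inj₁; inj₂)
open import Data.Vec as Vec using (Vec)
import Data.Vec.Properties as Vec
open import Data.Vec.Relation.Unary.All as All using (All)
open import Function using (_⇔_; mk⇔; Equivalence)
open Equivalence using (to; from)
open import Function.Properties.Equivalence using () renaming (trans to ⇔-trans; sym to ⇔-sym)
open import Level using (0ℓ)
open import Relation.Binary.PropositionalEquality
  using (_≡_; _≢_; refl; sym; trans; cong; cong₂; subst; module ≡-Reasoning)
open import Relation.Nullary using (contradiction)
open import Relation.Unary using (Pred; Decidable)

-- The integer operations are opened only inside this module: the theorem at the end is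
-- stated with the operations on ℕ.
module _ where
  open import Data.Integer using (_+_; _-_; _*_)

  parity : ∀ i → ∃[ k ] (i ≡ + 2 * k ⊎ i ≡ + 2 * k + 1ℤ)
  parity i = classify (i %ℕ 2) (i /ℕ 2) (n%ℕd<d i 2) (a≡a%ℕn+[a/ℕn]*n i 2)
    where
    classify : ∀ r q → r ℕ.< 2 → i ≡ + r + q * + 2 → ∃[ k ] (i ≡ + 2 * k ⊎ i ≡ + 2 * k + 1ℤ)
    classify 0 q _ i≡2q   = q , inj₁ (trans i≡2q (solve (q ∷ [])))
    classify 1 q _ i≡2q+1 = q , inj₂ (trans i≡2q+1 (solve (q ∷ [])))
    classify (suc (suc _)) _ (ℕ.s≤s (ℕ.s≤s ())) _

  even≢odd : ∀ k j → + 2 * k ≢ + 2 * j + 1ℤ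
  even≢odd k j eq
    with ℕ.m*n≡1⇒m≡1 2 ∣ k - j ∣ (trans (sym (Int.abs-* (+ 2) (k - j))) (cong ∣_∣ 2[k-j]≡1))
    where
    2[k-j]≡1 : + 2 * (k - j) ≡ 1ℤ
    2[k-j]≡1 = begin
      + 2 * (k - j)           ≡⟨ solve (k ∷ j ∷ []) ⟩
      + 2 * k - + 2 * j       ≡⟨ cong (_- + 2 * j) eq ⟩
      + 2 * j + 1ℤ - + 2 * j  ≡⟨ solve (j ∷ []) ⟩
      1ℤ                      ∎
      where open ≡-Reasoning
  ... | ()

  Odd⇒+≡2k+1 : ∀ {a} → Odd a → ∃[ k ] + a ≡ + 2 * k + 1ℤ
  Odd⇒+≡2k+1 {a} odd with parity (+ a)
  ... | k , inj₂ a≡2k+1 = k , a≡2k+1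
  ... | k , inj₁ a≡2k   = contradiction (divides ∣ k ∣ a≡∣k∣*2) odd
    where
    a≡∣k∣*2 : a ≡ ∣ k ∣ ℕ.* 2
    a≡∣k∣*2 = trans (cong ∣_∣ a≡2k) (trans (Int.abs-* (+ 2) k) (ℕ.*-comm 2 ∣ k ∣))

  data PairView : ℤ → ℤ → Set where
    sum-diff   : ∀ z₁ z₂ → PairView (z₁ + z₂) (z₁ - z₂)
    sum-diff-1 : ∀ x₁ x₂ → PairView (x₁ + x₂ - 1ℤ) (x₁ - x₂)

  sum-diff-view : ∀ z₁ z₂ {u₁ u₂} → z₁ + z₂ ≡ u₁ → z₁ - z₂ ≡ u₂ → PairView u₁ u₂
  sum-diff-view z₁ z₂ refl refl = sum-diff z₁ z₂

  sum-diff-1-view : ∀ x₁ x₂ {u₁ u₂} → x₁ + x₂ - 1ℤ ≡ u₁ → x₁ - x₂ ≡ u₂ → PairView u₁ u₂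
  sum-diff-1-view x₁ x₂ refl refl = sum-diff-1 x₁ x₂

  pairView : ∀ u₁ u₂ → PairView u₁ u₂
  pairView u₁ u₂ with parity (u₁ + u₂)
  ... | k , inj₁ u₁+u₂≡2k = sum-diff-view k (k - u₂) (begin
      k + (k - u₂)  ≡⟨ solve (k ∷ u₂ ∷ []) ⟩
      + 2 * k - u₂  ≡⟨ cong (_- u₂) u₁+u₂≡2k ⟨
      u₁ + u₂ - u₂  ≡⟨ solve (u₁ ∷ u₂ ∷ []) ⟩
      u₁            ∎) (solve (k ∷ u₂ ∷ []))
    where open ≡-Reasoning
  ... | k , inj₂ u₁+u₂≡2k+1 = sum-diff-1-view (k + 1ℤ) (k + 1ℤ - u₂) (begin
      k + 1ℤ + (k + 1ℤ - u₂) - 1ℤ  ≡⟨ solve (k ∷ u₂ ∷ []) ⟩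
      + 2 * k + 1ℤ - u₂            ≡⟨ cong (_- u₂) u₁+u₂≡2k+1 ⟨
      u₁ + u₂ - u₂                 ≡⟨ solve (u₁ ∷ u₂ ∷ []) ⟩
      u₁                           ∎) (solve (k ∷ u₂ ∷ []))
    where open ≡-Reasoning

  sum-diff-injective : ∀ {z₁ z₂ w₁ w₂} → z₁ + z₂ ≡ w₁ + w₂ → z₁ - z₂ ≡ w₁ - w₂ → z₁ ≡ w₁ × z₂ ≡ w₂
  sum-diff-injective {z₁} {z₂} {w₁} {w₂} sum≡ diff≡ =
    z₁≡w₁ , +-cancelˡ w₁ z₂ w₂ (trans (cong (_+ z₂) (sym z₁≡w₁)) sum≡)
    where
    open ≡-Reasoning
    z₁≡w₁ : z₁ ≡ w₁
    z₁≡w₁ = Int.*-cancelˡ-≡ (+ 2) z₁ w₁ (begin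
      + 2 * z₁               ≡⟨ solve (z₁ ∷ z₂ ∷ []) ⟩
      (z₁ + z₂) + (z₁ - z₂)  ≡⟨ cong₂ _+_ sum≡ diff≡ ⟩
      (w₁ + w₂) + (w₁ - w₂)  ≡⟨ solve (w₁ ∷ w₂ ∷ []) ⟩
      + 2 * w₁               ∎)

  sum-diff-1-injective : ∀ {x₁ x₂ y₁ y₂} → x₁ + x₂ - 1ℤ ≡ y₁ + y₂ - 1ℤ → x₁ - x₂ ≡ y₁ - y₂ →
    x₁ ≡ y₁ × x₂ ≡ y₂
  sum-diff-1-injective sum≡ = sum-diff-injective (+-cancelʳ (- 1ℤ) _ _ sum≡)

  sum-diff≢sum-diff-1 : ∀ {z₁ z₂ x₁ x₂} → z₁ + z₂ ≡ x₁ + x₂ - 1ℤ → z₁ - z₂ ≡ x₁ - x₂ → ⊥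
  sum-diff≢sum-diff-1 {z₁} {z₂} {x₁} {x₂} sum≡ diff≡ = even≢odd z₁ (x₁ - 1ℤ) (begin
    + 2 * z₁                    ≡⟨ solve (z₁ ∷ z₂ ∷ []) ⟩
    (z₁ + z₂) + (z₁ - z₂)       ≡⟨ cong₂ _+_ sum≡ diff≡ ⟩
    (x₁ + x₂ - 1ℤ) + (x₁ - x₂)  ≡⟨ solve (x₁ ∷ x₂ ∷ []) ⟩
    + 2 * (x₁ - 1ℤ) + 1ℤ        ∎)
    where open ≡-Reasoning

  triangular : ℕ → ℕ
  triangular zero    = 0
  triangular (suc m) = suc m ℕ.+ triangular m

  triangular*2 : ∀ m → triangular m ℕ.* 2 ≡ m ℕ.* suc m
  triangular*2 zero    = refl
  triangular*2 (suc m) = begin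
    (suc m ℕ.+ triangular m) ℕ.* 2      ≡⟨ ℕ.*-distribʳ-+ 2 (suc m) (triangular m) ⟩
    suc m ℕ.* 2 ℕ.+ triangular m ℕ.* 2  ≡⟨ cong (suc m ℕ.* 2 ℕ.+_) (triangular*2 m) ⟩
    suc m ℕ.* 2 ℕ.+ m ℕ.* suc m         ≡⟨ ℕ-Solver.solve (m ∷ []) ⟩
    suc m ℕ.* suc (suc m)               ∎
    where open ≡-Reasoning

  m≤triangular[m] : ∀ m → m ≤ triangular m
  m≤triangular[m] zero    = ℕ.z≤n
  m≤triangular[m] (suc m) = ℕ.m≤m+n (suc m) (triangular m)

  triIndex : ℤ → ℕ
  triIndex (+ zero)  = 0
  triIndex (+ suc j) = j
  triIndex -[1+ j ]  = suc j

  x[x-1]≡m[m+1] : ∀ x → x * (x - 1ℤ) ≡ + (triIndex x ℕ.* suc (triIndex x))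
  x[x-1]≡m[m+1] (+ zero)  = refl
  x[x-1]≡m[m+1] (+ suc j) = trans (sym (Int.pos-* (suc j) j)) (cong +_ (ℕ.*-comm (suc j) j))
  x[x-1]≡m[m+1] -[1+ j ]  = cong (λ k → + (suc j ℕ.* suc (suc k))) (ℕ.+-identityʳ j)

  ∣x∣≤1+triIndex : ∀ x → ∣ x ∣ ≤ suc (triIndex x)
  ∣x∣≤1+triIndex (+ zero)  = ℕ.z≤n
  ∣x∣≤1+triIndex (+ suc j) = ℕ.≤-refl
  ∣x∣≤1+triIndex -[1+ j ]  = ℕ.n≤1+n (suc j)

  triℕ : ℤ → ℕ
  triℕ x = triangular (triIndex x)

  ∣x∣≤1+triℕ : ∀ x → ∣ x ∣ ≤ suc (triℕ x)
  ∣x∣≤1+triℕ x = ℕ.≤-trans (∣x∣≤1+triIndex x) (ℕ.s≤s (m≤triangular[m] (triIndex x)))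

  tri≡+triℕ : ∀ x → tri x ≡ + triℕ x
  tri≡+triℕ x = begin
    (x * (x - 1ℤ)) /ℕ 2             ≡⟨ cong (_/ℕ 2) (x[x-1]≡m[m+1] x) ⟩
    + (m ℕ.* suc m) /ℕ 2            ≡⟨ cong (λ k → + k /ℕ 2) (triangular*2 m) ⟨
    + (triangular m ℕ.* 2 ℕ./ 2)    ≡⟨ cong +_ (m*n/n≡m (triangular m) 2) ⟩
    + triangular m                  ∎
    where
    open ≡-Reasoning
    m : ℕ
    m = triIndex x

  2*tri : ∀ x → + 2 * tri x ≡ x * (x - 1ℤ)
  2*tri x = begin
    + 2 * tri x             ≡⟨ cong (+ 2 *_) (tri≡+triℕ x) ⟩
    + 2 * + triangular m    ≡⟨ Int.pos-* 2 (triangular m) ⟨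
    + (2 ℕ.* triangular m)  ≡⟨ cong +_ (trans (ℕ.*-comm 2 (triangular m)) (triangular*2 m)) ⟩
    + (m ℕ.* suc m)         ≡⟨ x[x-1]≡m[m+1] x ⟨
    x * (x - 1ℤ)            ∎
    where
    open ≡-Reasoning
    m : ℕ
    m = triIndex x

  sum-diff-squares : ∀ z₁ z₂ → (z₁ + z₂) * (z₁ + z₂) + (z₁ - z₂) * (z₁ - z₂) ≡ + 2 * (z₁ * z₁ + z₂ * z₂)
  sum-diff-squares = solve-∀

  sum-diff-1-squares : ∀ x₁ x₂ →
    (x₁ + x₂ - 1ℤ) * (x₁ + x₂ - 1ℤ) + (x₁ - x₂) * (x₁ - x₂) ≡ + 4 * (tri x₁ + tri x₂) + 1ℤ
  sum-diff-1-squares x₁ x₂ = begin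
    (x₁ + x₂ - 1ℤ) * (x₁ + x₂ - 1ℤ) + (x₁ - x₂) * (x₁ - x₂)
      ≡⟨ solve (x₁ ∷ x₂ ∷ []) ⟩
    + 2 * (x₁ * (x₁ - 1ℤ) + x₂ * (x₂ - 1ℤ)) + 1ℤ
      ≡⟨ cong₂ (λ p q → + 2 * (p + q) + 1ℤ) (2*tri x₁) (2*tri x₂) ⟨
    + 2 * (+ 2 * tri x₁ + + 2 * tri x₂) + 1ℤ
      ≡⟨ distrib (tri x₁) (tri x₂) ⟩
    + 4 * (tri x₁ + tri x₂) + 1ℤ
      ∎
    where
    open ≡-Reasoning
    distrib : ∀ s t → + 2 * (+ 2 * s + + 2 * t) + 1ℤ ≡ + 4 * (s + t) + 1ℤ
    distrib = solve-∀

  A*Q+B*R≢4N+A+B : ∀ {A B Q R} P T N → (∃[ k ] A ≡ + 2 * k + 1ℤ) → Q ≡ + 2 * P → R ≡ + 4 * T + 1ℤ →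
    A * Q + B * R ≢ + 4 * N + A + B
  A*Q+B*R≢4N+A+B {B = B} P T N (k , refl) refl refl eq =
    even≢odd ((+ 2 * k + 1ℤ) * P + + 2 * B * T) (+ 2 * N + k) (+-cancelʳ B _ _ (begin
      + 2 * ((+ 2 * k + 1ℤ) * P + + 2 * B * T) + B      ≡⟨ solve (k ∷ B ∷ P ∷ T ∷ []) ⟩
      (+ 2 * k + 1ℤ) * (+ 2 * P) + B * (+ 4 * T + 1ℤ)  ≡⟨ eq ⟩
      + 4 * N + (+ 2 * k + 1ℤ) + B                      ≡⟨ solve (N ∷ k ∷ B ∷ []) ⟩
      + 2 * (+ 2 * N + k) + 1ℤ + B                      ∎))
    where open ≡-Reasoning

  B*R+A*Q≢4N+B+A : ∀ {A B Q R} P T N → (∃[ k ] A ≡ + 2 * k + 1ℤ) → Q ≡ + 2 * P → R ≡ + 4 * T + 1ℤ →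
    B * R + A * Q ≢ + 4 * N + B + A
  B*R+A*Q≢4N+B+A {A} {B} {Q} {R} P T N odd Q≡2P R≡4T+1 eq = A*Q+B*R≢4N+A+B P T N odd Q≡2P R≡4T+1
    (trans (Int.+-comm (A * Q) (B * R)) (trans eq (+-swapʳ (+ 4 * N) B A)))

  -- Opened only now: while list and vector constructors are both in scope, the variable
  -- lists passed to the ring solver's solve elaborate very slowly.
  open import Data.Vec using ([]; _∷_)
  open import Data.Vec.Relation.Unary.All using ([]; _∷_)

  unique∧same-elements⇒length≡ : ∀ {A : Set} {xs ys : List A} → Unique xs → Unique ys →
    (∀ {z} → z ∈ xs ⇔ z ∈ ys) → length xs ≡ length ys
  unique∧same-elements⇒length≡ xs! ys! xs≈ys = ↭-length (∼bag⇒↭ (unique∧set⇒bag xs! ys! xs≈ys))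

  concatMap≡cartesianProductWith : ∀ {A B C : Set} (f : A → B → C) xs ys →
    concatMap (λ x → map (f x) ys) xs ≡ cartesianProductWith f xs ys
  concatMap≡cartesianProductWith f []       ys = refl
  concatMap≡cartesianProductWith f (x ∷ xs) ys =
    cong (map (f x) ys ++_) (concatMap≡cartesianProductWith f xs ys)

  tuples-suc : ∀ k m → tuples (suc k) m ≡ cartesianProductWith _∷_ (box m) (tuples k m)
  tuples-suc k m = concatMap≡cartesianProductWith _∷_ (box m) (tuples k m)

  box-unique : ∀ m → Unique (box m)
  box-unique m = Unique.map⁺ shift-injective (Unique.upTo⁺ (suc (2 ℕ.* m)))
    where
    shift-injective : ∀ {i j} → + i - + m ≡ + j - + m → i ≡ j
    shift-injective {i} {j} eq = Int.+-injective (+-cancelʳ (- + m) (+ i) (+ j) eq)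

  tuples-unique : ∀ k m → Unique (tuples k m)
  tuples-unique zero    m = List.[] ∷ []
  tuples-unique (suc k) m = subst Unique (sym (tuples-suc k m))
    (Unique.cartesianProductWith⁺ _∷_ Vec.∷-injective (box-unique m) (tuples-unique k m))

  ∈-box : ∀ {m x} → ∣ x ∣ ≤ m → x ∈ box m
  ∈-box {m} {+ k} k≤m = subst (_∈ box m) shift≡x (∈.∈-map⁺ (λ i → + i - + m) (∈.∈-upTo⁺ k+m<1+2m))
    where
    k+m<1+2m : k ℕ.+ m ℕ.< suc (2 ℕ.* m)
    k+m<1+2m = ℕ.s≤s (ℕ.+-mono-≤ k≤m (ℕ.m≤n*m m 1))
    i+j-j≡i : ∀ i j → i + j - j ≡ i
    i+j-j≡i = solve-∀
    shift≡x : + (k ℕ.+ m) - + m ≡ + k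
    shift≡x = trans (cong (_- + m) (Int.pos-+ k m)) (i+j-j≡i (+ k) (+ m))
  ∈-box {m} { -[1+ k ]} 1+k≤m with ℕ.m≤n⇒∃[o]m+o≡n 1+k≤m
  ... | j , refl = subst (_∈ box m) shift≡x (∈.∈-map⁺ (λ i → + i - + m) (∈.∈-upTo⁺ j<1+2m))
    where
    j<1+2m : j ℕ.< suc (2 ℕ.* m)
    j<1+2m = ℕ.s≤s (ℕ.≤-trans (ℕ.m≤n+m j (suc k)) (ℕ.m≤n*m (suc k ℕ.+ j) 2))
    j-[i+j]≡-i : ∀ i j → j - (i + j) ≡ - i
    j-[i+j]≡-i = solve-∀
    shift≡x : + j - + m ≡ -[1+ k ]
    shift≡x = trans (cong (λ i → + j - i) (Int.pos-+ (suc k) j)) (j-[i+j]≡-i (+ suc k) (+ j))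

  ∈-tuples : ∀ {k m} {x : Vec ℤ k} → All (λ y → ∣ y ∣ ≤ m) x → x ∈ tuples k m
  ∈-tuples [] = here refl
  ∈-tuples {suc k} {m} (y≤m ∷ ys≤m) = subst (_ ∈_) (sym (tuples-suc k m))
    (∈.∈-cartesianProductWith⁺ _∷_ (∈-box y≤m) (∈-tuples ys≤m))

  module _ {k} {P : Pred (Vec ℤ k) 0ℓ} (P? : Decidable P) where

    filter-tuples-unique : ∀ m → Unique (filter P? (tuples k m))
    filter-tuples-unique m = Unique.filter⁺ P? (tuples-unique k m)

    module _ {m} (bounded : ∀ {x} → P x → All (λ y → ∣ y ∣ ≤ m) x) where

      ∈-filter-tuples : ∀ {x} → x ∈ filter P? (tuples k m) ⇔ P x
      ∈-filter-tuples = mk⇔ (λ x∈ → proj₂ (∈.∈-filter⁻ P? {xs = tuples k m} x∈))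
                            (λ Px → ∈.∈-filter⁺ P? (∈-tuples (bounded Px)) Px)

      length-filter-tuples : ∀ {ys} → Unique ys → (∀ {x} → x ∈ ys ⇔ P x) →
        length (filter P? (tuples k m)) ≡ length ys
      length-filter-tuples ys! ∈ys = unique∧same-elements⇒length≡ (filter-tuples-unique m) ys!
        (⇔-trans ∈-filter-tuples (⇔-sym ∈ys))

  weightedSum : ∀ {k} → (ℤ → ℕ) → Vec ℕ k → Vec ℤ k → ℕ
  weightedSum g []       []       = 0
  weightedSum g (a ∷ as) (x ∷ xs) = a ℕ.* g x ℕ.+ weightedSum g as xs

  term≤weightedSum : ∀ {k} g {a : Vec ℕ k} {x} → All (1 ≤_) a → All (λ y → g y ≤ weightedSum g a x) x
  term≤weightedSum g {[]}     {[]}     []           = []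
  term≤weightedSum g {a ∷ as} {x ∷ xs} (1≤a ∷ 1≤as) =
    ℕ.≤-trans (ℕ.m≤n*m (g x) 1) (ℕ.≤-trans (ℕ.*-monoˡ-≤ (g x) 1≤a) (ℕ.m≤m+n (a ℕ.* g x) _)) ∷
    All.map (λ gy≤ → ℕ.≤-trans gy≤ (ℕ.m≤n+m _ (a ℕ.* g x))) (term≤weightedSum g 1≤as)

  weightedSum-solution-bounded : ∀ {k} g → (∀ y → ∣ y ∣ ≤ suc (g y)) → ∀ {a : Vec ℕ k} {x n} →
    All (1 ≤_) a → weightedSum g a x ≡ n → All (λ y → ∣ y ∣ ≤ suc n) x
  weightedSum-solution-bounded g ∣y∣≤1+gy 1≤a refl =
    All.map (λ {y} gy≤ → ℕ.≤-trans (∣y∣≤1+gy y) (ℕ.s≤s gy≤)) (term≤weightedSum g 1≤a)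

  pos-*-+ : ∀ a p q → + a * + p + + q ≡ + (a ℕ.* p ℕ.+ q)
  pos-*-+ a p q = trans (cong (_+ + q) (sym (Int.pos-* a p))) (sym (Int.pos-+ (a ℕ.* p) q))

  square : ℤ → ℕ
  square y = ∣ y ∣ ℕ.* ∣ y ∣

  x*x≡+square : ∀ x → x * x ≡ + square x
  x*x≡+square (+ k)    = sym (Int.pos-* k k)
  x*x≡+square -[1+ k ] = refl

  ∣x∣≤1+square : ∀ x → ∣ x ∣ ≤ suc (square x)
  ∣x∣≤1+square x with ∣ x ∣
  ... | zero  = ℕ.z≤n
  ... | suc j = ℕ.m≤n⇒m≤1+n (ℕ.m≤m*n (suc j) (suc j))

  sqForm≡weightedSum : ∀ {k} (a : Vec ℕ k) x → sqForm a x ≡ + weightedSum square a x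
  sqForm≡weightedSum []       []       = refl
  sqForm≡weightedSum (a ∷ as) (x ∷ xs) = trans
    (cong₂ (λ s r → + a * s + r) (x*x≡+square x) (sqForm≡weightedSum as xs))
    (pos-*-+ a (square x) _)

  sqForm-solution-bounded : ∀ {k} {a : Vec ℕ k} {x n} → All (1 ≤_) a → sqForm a x ≡ + n →
    All (λ y → ∣ y ∣ ≤ suc n) x
  sqForm-solution-bounded {a = a} {x} 1≤a eq = weightedSum-solution-bounded square ∣x∣≤1+square 1≤a
    (Int.+-injective (trans (sym (sqForm≡weightedSum a x)) eq))

  triForm≡weightedSum : ∀ {k} (a : Vec ℕ k) x → triForm a x ≡ + weightedSum triℕ a x
  triForm≡weightedSum []       []       = refl
  triForm≡weightedSum (a ∷ as) (x ∷ xs) = trans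
    (cong₂ (λ s r → + a * s + r) (tri≡+triℕ x) (triForm≡weightedSum as xs))
    (pos-*-+ a (triℕ x) _)

  triForm-solution-bounded : ∀ {k} {a : Vec ℕ k} {x n} → All (1 ≤_) a → triForm a x ≡ + n →
    All (λ y → ∣ y ∣ ≤ suc n) x
  triForm-solution-bounded {a = a} {x} 1≤a eq =
    weightedSum-solution-bounded triℕ ∣x∣≤1+triℕ 1≤a
      (Int.+-injective (trans (sym (triForm≡weightedSum a x)) eq))

  distrib-pairs : ∀ A B p₁ p₂ p₃ p₄ →
    A * p₁ + (A * p₂ + (B * p₃ + (B * p₄ + + 0))) ≡ A * (p₁ + p₂) + B * (p₃ + p₄)
  distrib-pairs = solve-∀

  sqForm-pairs : ∀ a b u₁ u₂ u₃ u₄ → sqForm (a ∷ a ∷ b ∷ b ∷ []) (u₁ ∷ u₂ ∷ u₃ ∷ u₄ ∷ []) ≡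
    + a * (u₁ * u₁ + u₂ * u₂) + + b * (u₃ * u₃ + u₄ * u₄)
  sqForm-pairs a b u₁ u₂ u₃ u₄ = distrib-pairs (+ a) (+ b) (u₁ * u₁) (u₂ * u₂) (u₃ * u₃) (u₄ * u₄)

  triForm-pairs : ∀ a b x₁ x₂ x₃ x₄ → triForm (a ∷ a ∷ b ∷ b ∷ []) (x₁ ∷ x₂ ∷ x₃ ∷ x₄ ∷ []) ≡
    + a * (tri x₁ + tri x₂) + + b * (tri x₃ + tri x₄)
  triForm-pairs a b x₁ x₂ x₃ x₄ = distrib-pairs (+ a) (+ b) (tri x₁) (tri x₂) (tri x₃) (tri x₄)

  sumDiff : Vec ℤ 4 → Vec ℤ 4
  sumDiff (z₁ ∷ z₂ ∷ z₃ ∷ z₄ ∷ []) = z₁ + z₂ ∷ z₁ - z₂ ∷ z₃ + z₄ ∷ z₃ - z₄ ∷ []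

  sumDiff-1 : Vec ℤ 4 → Vec ℤ 4
  sumDiff-1 (x₁ ∷ x₂ ∷ x₃ ∷ x₄ ∷ []) = x₁ + x₂ - 1ℤ ∷ x₁ - x₂ ∷ x₃ + x₄ - 1ℤ ∷ x₃ - x₄ ∷ []

  ∷-injective⁴ : ∀ {A : Set} {a₁ a₂ a₃ a₄ b₁ b₂ b₃ b₄ : A} →
    _≡_ {A = Vec A 4} (a₁ ∷ a₂ ∷ a₃ ∷ a₄ ∷ []) (b₁ ∷ b₂ ∷ b₃ ∷ b₄ ∷ []) →
    a₁ ≡ b₁ × a₂ ≡ b₂ × a₃ ≡ b₃ × a₄ ≡ b₄
  ∷-injective⁴ refl = refl , refl , refl , refl

  sumDiff-injective : ∀ {z w} → sumDiff z ≡ sumDiff w → z ≡ w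
  sumDiff-injective {z₁ ∷ z₂ ∷ z₃ ∷ z₄ ∷ []} {w₁ ∷ w₂ ∷ w₃ ∷ w₄ ∷ []} eq
    with e₁ , e₂ , e₃ , e₄ ← ∷-injective⁴ eq
    with refl , refl ← sum-diff-injective {z₁} {z₂} {w₁} {w₂} e₁ e₂
    with refl , refl ← sum-diff-injective {z₃} {z₄} {w₃} {w₄} e₃ e₄ = refl

  sumDiff-1-injective : ∀ {x y} → sumDiff-1 x ≡ sumDiff-1 y → x ≡ y
  sumDiff-1-injective {x₁ ∷ x₂ ∷ x₃ ∷ x₄ ∷ []} {y₁ ∷ y₂ ∷ y₃ ∷ y₄ ∷ []} eq
    with e₁ , e₂ , e₃ , e₄ ← ∷-injective⁴ eq
    with refl , refl ← sum-diff-1-injective {x₁} {x₂} {y₁} {y₂} e₁ e₂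
    with refl , refl ← sum-diff-1-injective {x₃} {x₄} {y₃} {y₄} e₃ e₄ = refl

  sumDiff≢sumDiff-1 : ∀ z x → sumDiff z ≢ sumDiff-1 x
  sumDiff≢sumDiff-1 (z₁ ∷ z₂ ∷ _ ∷ _ ∷ []) (x₁ ∷ x₂ ∷ _ ∷ _ ∷ []) eq
    with e₁ , e₂ , _ ← ∷-injective⁴ eq = sum-diff≢sum-diff-1 {z₁} {z₂} {x₁} {x₂} e₁ e₂

  sqForm-sumDiff : ∀ a b z →
    sqForm (a ∷ a ∷ b ∷ b ∷ []) (sumDiff z) ≡ + 2 * sqForm (a ∷ a ∷ b ∷ b ∷ []) z
  sqForm-sumDiff a b (z₁ ∷ z₂ ∷ z₃ ∷ z₄ ∷ []) = begin
    sqForm (a ∷ a ∷ b ∷ b ∷ []) (sumDiff (z₁ ∷ z₂ ∷ z₃ ∷ z₄ ∷ []))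
      ≡⟨ sqForm-pairs a b (z₁ + z₂) (z₁ - z₂) (z₃ + z₄) (z₃ - z₄) ⟩
    + a * ((z₁ + z₂) * (z₁ + z₂) + (z₁ - z₂) * (z₁ - z₂)) +
    + b * ((z₃ + z₄) * (z₃ + z₄) + (z₃ - z₄) * (z₃ - z₄))
      ≡⟨ cong₂ (λ p q → + a * p + + b * q) (sum-diff-squares z₁ z₂) (sum-diff-squares z₃ z₄) ⟩
    + a * (+ 2 * P₁₂) + + b * (+ 2 * P₃₄)
      ≡⟨ factor (+ a) (+ b) P₁₂ P₃₄ ⟩
    + 2 * (+ a * P₁₂ + + b * P₃₄)
      ≡⟨ cong (+ 2 *_) (sqForm-pairs a b z₁ z₂ z₃ z₄) ⟨
    + 2 * sqForm (a ∷ a ∷ b ∷ b ∷ []) (z₁ ∷ z₂ ∷ z₃ ∷ z₄ ∷ [])  ∎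
    where
    open ≡-Reasoning
    P₁₂ P₃₄ : ℤ
    P₁₂ = z₁ * z₁ + z₂ * z₂
    P₃₄ = z₃ * z₃ + z₄ * z₄
    factor : ∀ A B P Q → A * (+ 2 * P) + B * (+ 2 * Q) ≡ + 2 * (A * P + B * Q)
    factor = solve-∀

  sqForm-sumDiff-1 : ∀ a b x →
    sqForm (a ∷ a ∷ b ∷ b ∷ []) (sumDiff-1 x) ≡ + 4 * triForm (a ∷ a ∷ b ∷ b ∷ []) x + + a + + b
  sqForm-sumDiff-1 a b (x₁ ∷ x₂ ∷ x₃ ∷ x₄ ∷ []) = begin
    sqForm (a ∷ a ∷ b ∷ b ∷ []) (sumDiff-1 (x₁ ∷ x₂ ∷ x₃ ∷ x₄ ∷ []))
      ≡⟨ sqForm-pairs a b (x₁ + x₂ - 1ℤ) (x₁ - x₂) (x₃ + x₄ - 1ℤ) (x₃ - x₄) ⟩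
    + a * ((x₁ + x₂ - 1ℤ) * (x₁ + x₂ - 1ℤ) + (x₁ - x₂) * (x₁ - x₂)) +
    + b * ((x₃ + x₄ - 1ℤ) * (x₃ + x₄ - 1ℤ) + (x₃ - x₄) * (x₃ - x₄))
      ≡⟨ cong₂ (λ p q → + a * p + + b * q) (sum-diff-1-squares x₁ x₂) (sum-diff-1-squares x₃ x₄) ⟩
    + a * (+ 4 * T₁₂ + 1ℤ) + + b * (+ 4 * T₃₄ + 1ℤ)
      ≡⟨ factor (+ a) (+ b) T₁₂ T₃₄ ⟩
    + 4 * (+ a * T₁₂ + + b * T₃₄) + + a + + b
      ≡⟨ cong (λ s → + 4 * s + + a + + b) (triForm-pairs a b x₁ x₂ x₃ x₄) ⟨
    + 4 * triForm (a ∷ a ∷ b ∷ b ∷ []) (x₁ ∷ x₂ ∷ x₃ ∷ x₄ ∷ []) + + a + + b  ∎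
    where
    open ≡-Reasoning
    T₁₂ T₃₄ : ℤ
    T₁₂ = tri x₁ + tri x₂
    T₃₄ = tri x₃ + tri x₄
    factor : ∀ A B S T → A * (+ 4 * S + 1ℤ) + B * (+ 4 * T + 1ℤ) ≡ + 4 * (A * S + B * T) + A + B
    factor = solve-∀

  sqForm≡4n+a+b⇒image : ∀ {a b} → Odd a → Odd b → ∀ n u →
    sqForm (a ∷ a ∷ b ∷ b ∷ []) u ≡ + 4 * + n + + a + + b →
    (∃[ x ] u ≡ sumDiff-1 x) ⊎ (∃[ z ] u ≡ sumDiff z)
  sqForm≡4n+a+b⇒image {a} {b} odd-a odd-b n (u₁ ∷ u₂ ∷ u₃ ∷ u₄ ∷ []) eq
    with pairView u₁ u₂ | pairView u₃ u₄ | trans (sym (sqForm-pairs a b u₁ u₂ u₃ u₄)) eq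
  ... | sum-diff z₁ z₂   | sum-diff z₃ z₄   | _   = inj₂ (z₁ ∷ z₂ ∷ z₃ ∷ z₄ ∷ [] , refl)
  ... | sum-diff-1 x₁ x₂ | sum-diff-1 x₃ x₄ | _   = inj₁ (x₁ ∷ x₂ ∷ x₃ ∷ x₄ ∷ [] , refl)
  ... | sum-diff z₁ z₂   | sum-diff-1 x₃ x₄ | eq′ =
    ⊥-elim (A*Q+B*R≢4N+A+B (z₁ * z₁ + z₂ * z₂) (tri x₃ + tri x₄) (+ n) (Odd⇒+≡2k+1 odd-a)
      (sum-diff-squares z₁ z₂) (sum-diff-1-squares x₃ x₄) eq′)
  ... | sum-diff-1 x₁ x₂ | sum-diff z₃ z₄   | eq′ =
    ⊥-elim (B*R+A*Q≢4N+B+A (z₃ * z₃ + z₄ * z₄) (tri x₁ + tri x₂) (+ n) (Odd⇒+≡2k+1 odd-b)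
      (sum-diff-squares z₃ z₄) (sum-diff-1-squares x₁ x₂) eq′)

  sqForm-sumDiff-1≡4n+a+b⇔ : ∀ a b n x →
    sqForm (a ∷ a ∷ b ∷ b ∷ []) (sumDiff-1 x) ≡ + 4 * + n + + a + + b ⇔
    triForm (a ∷ a ∷ b ∷ b ∷ []) x ≡ + n
  sqForm-sumDiff-1≡4n+a+b⇔ a b n x = mk⇔
    (λ eq → Int.*-cancelˡ-≡ (+ 4) _ _ (+-cancelʳ (+ a) _ _ (+-cancelʳ (+ b) _ _
      (trans (sym (sqForm-sumDiff-1 a b x)) eq))))
    (λ eq → trans (sqForm-sumDiff-1 a b x) (cong (λ s → + 4 * s + + a + + b) eq))

  sqForm-sumDiff≡2h⇔ : ∀ a b h z →
    sqForm (a ∷ a ∷ b ∷ b ∷ []) (sumDiff z) ≡ + 2 * + h ⇔ sqForm (a ∷ a ∷ b ∷ b ∷ []) z ≡ + h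
  sqForm-sumDiff≡2h⇔ a b h z = mk⇔
    (λ eq → Int.*-cancelˡ-≡ (+ 2) _ _ (trans (sym (sqForm-sumDiff a b z)) eq))
    (λ eq → trans (sqForm-sumDiff a b z) (cong (+ 2 *_) eq))

  module _ {a b : ℕ} (odd-a : Odd a) (odd-b : Odd b) (1≤a : 1 ≤ a) (1≤b : 1 ≤ b)
           (n h : ℕ) (M≡2h : 4 ℕ.* n ℕ.+ a ℕ.+ b ≡ 2 ℕ.* h) where
    private
      w : Vec ℕ 4
      w = a ∷ a ∷ b ∷ b ∷ []

      M : ℕ
      M = 4 ℕ.* n ℕ.+ a ℕ.+ b

      1≤w : All (1 ≤_) w
      1≤w = 1≤a ∷ 1≤a ∷ 1≤b ∷ 1≤b ∷ []

      +M≡4n+a+b : + M ≡ + 4 * + n + + a + + b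
      +M≡4n+a+b = trans (Int.pos-+ _ b)
        (cong (_+ + b) (trans (Int.pos-+ _ a) (cong (_+ + a) (Int.pos-* 4 n))))

      +M≡2h : + M ≡ + 2 * + h
      +M≡2h = trans (cong +_ M≡2h) (Int.pos-* 2 h)

      tri? : Decidable (λ x → triForm w x ≡ + n)
      tri? x = triForm w x ≟ + n

      sq? : ∀ m → Decidable (λ x → sqForm w x ≡ + m)
      sq? m x = sqForm w x ≟ + m

      triSols : List (Vec ℤ 4)
      triSols = filter tri? (tuples 4 (suc n))

      sqSols : List (Vec ℤ 4)
      sqSols = filter (sq? h) (tuples 4 (suc h))

      images : List (Vec ℤ 4)
      images = map sumDiff-1 triSols ++ map sumDiff sqSols

      ∈triSols⇔ : ∀ {x} → x ∈ triSols ⇔ triForm w x ≡ + n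
      ∈triSols⇔ = ∈-filter-tuples tri? (triForm-solution-bounded 1≤w)

      ∈sqSols⇔ : ∀ {z} → z ∈ sqSols ⇔ sqForm w z ≡ + h
      ∈sqSols⇔ = ∈-filter-tuples (sq? h) (sqForm-solution-bounded 1≤w)

      images-disjoint : Disjoint (map sumDiff-1 triSols) (map sumDiff sqSols)
      images-disjoint (p , q) with ∈.∈-map⁻ sumDiff-1 p | ∈.∈-map⁻ sumDiff q
      ... | x , _ , refl | z , _ , eq = sumDiff≢sumDiff-1 z x (sym eq)

      images-unique : Unique images
      images-unique = Unique.++⁺
        (Unique.map⁺ sumDiff-1-injective (filter-tuples-unique tri? (suc n)))
        (Unique.map⁺ sumDiff-injective (filter-tuples-unique (sq? h) (suc h)))
        images-disjoint

      ∈images⇒solution : ∀ {u} → u ∈ images → sqForm w u ≡ + M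
      ∈images⇒solution u∈ with ∈.∈-++⁻ (map sumDiff-1 triSols) u∈
      ... | inj₁ u∈₁ with x , x∈ , refl ← ∈.∈-map⁻ sumDiff-1 u∈₁ =
        trans (from (sqForm-sumDiff-1≡4n+a+b⇔ a b n x) (to ∈triSols⇔ x∈)) (sym +M≡4n+a+b)
      ... | inj₂ u∈₂ with z , z∈ , refl ← ∈.∈-map⁻ sumDiff u∈₂ =
        trans (from (sqForm-sumDiff≡2h⇔ a b h z) (to ∈sqSols⇔ z∈)) (sym +M≡2h)

      solution⇒∈images : ∀ {u} → sqForm w u ≡ + M → u ∈ images
      solution⇒∈images {u} eq with sqForm≡4n+a+b⇒image odd-a odd-b n u (trans eq +M≡4n+a+b)
      ... | inj₁ (x , refl) = ∈.∈-++⁺ˡ (∈.∈-map⁺ sumDiff-1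
        (from ∈triSols⇔ (to (sqForm-sumDiff-1≡4n+a+b⇔ a b n x) (trans eq +M≡4n+a+b))))
      ... | inj₂ (z , refl) = ∈.∈-++⁺ʳ (map sumDiff-1 triSols) (∈.∈-map⁺ sumDiff
        (from ∈sqSols⇔ (to (sqForm-sumDiff≡2h⇔ a b h z) (trans eq +M≡2h))))

    N[4n+a+b]≡t[n]+N[h] : N w M ≡ t w n ℕ.+ N w h
    N[4n+a+b]≡t[n]+N[h] = begin
      N w M
        ≡⟨ length-filter-tuples (sq? M) (sqForm-solution-bounded 1≤w) images-unique
             (mk⇔ ∈images⇒solution solution⇒∈images) ⟩
      length images
        ≡⟨ length-++ (map sumDiff-1 triSols) ⟩
      length (map sumDiff-1 triSols) ℕ.+ length (map sumDiff sqSols)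
        ≡⟨ cong₂ ℕ._+_ (length-map sumDiff-1 triSols) (length-map sumDiff sqSols) ⟩
      t w n ℕ.+ N w h
        ∎
      where open ≡-Reasoning

open import Data.Nat using (_+_; _*_; _/_; _≥_)
open import Data.Vec using (_∷_; [])

Odd⇒%2≡1 : ∀ {a} → Odd a → a % 2 ≡ 1
Odd⇒%2≡1 {a} odd with a % 2 | m%n<n a 2 | m%n≡0⇒n∣m a 2
... | 0           | _                   | 2∣a = contradiction (2∣a refl) odd
... | 1           | _                   | _   = refl
... | suc (suc _) | ℕ.s≤s (ℕ.s≤s ()) | _

Odd+Odd⇒2∣ : ∀ {a b} → Odd a → Odd b → 2 ∣ a + b
Odd+Odd⇒2∣ {a} {b} odd-a odd-b = m%n≡0⇒n∣m (a + b) 2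
  (trans (%-distribˡ-+ a b 2) (cong₂ (λ r s → (r + s) % 2) (Odd⇒%2≡1 odd-a) (Odd⇒%2≡1 odd-b)))

4n+a+b≡2[2n+[a+b]/2] : ∀ n {a b} → 2 ∣ a + b → 4 * n + a + b ≡ 2 * (2 * n + (a + b) / 2)
4n+a+b≡2[2n+[a+b]/2] n {a} {b} 2∣a+b = begin
  4 * n + a + b                    ≡⟨ ℕ.+-assoc (4 * n) a b ⟩
  4 * n + (a + b)                  ≡⟨ cong (λ s → 4 * n + s) (m*[n/m]≡n 2∣a+b) ⟨
  4 * n + 2 * ((a + b) / 2)        ≡⟨ cong (_+ 2 * ((a + b) / 2)) (ℕ.*-assoc 2 2 n) ⟩
  2 * (2 * n) + 2 * ((a + b) / 2)  ≡⟨ ℕ.*-distribˡ-+ 2 (2 * n) ((a + b) / 2) ⟨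
  2 * (2 * n + (a + b) / 2)        ∎
  where open ≡-Reasoning

theorem5p13 : (a b n : ℕ) → Odd a → Odd b → a ≥ 1 → b ≥ 1 → n ≥ 1 →
    t (a ∷ a ∷ b ∷ b ∷ []) n + N (a ∷ a ∷ b ∷ b ∷ []) (2 * n + (a + b) / 2)
      ≡ N (a ∷ a ∷ b ∷ b ∷ []) (4 * n + a + b)
theorem5p13 a b n odd-a odd-b a≥1 b≥1 _ = sym (N[4n+a+b]≡t[n]+N[h] odd-a odd-b a≥1 b≥1 n _
  (4n+a+b≡2[2n+[a+b]/2] n (Odd+Odd⇒2∣ odd-a odd-b)))
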